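{- Let $G$ be a finite simple graph without isolated vertices. Then $$\alpha(G)\leq \tau(G)\,[1+\alpha(G)-\sigma_{v}(G)].$$
   Context: A stable (independent) set of $G$ is a set of pairwise nonadjacent vertices; it is maximal if it is maximal with respect to inclusion. $\alpha(G)$ is the stability number of $G$, i.e. the maximum cardinality of a stable set of $G$. A vertex cover of $G$ is a set of vertices meeting every edge; $\tau(G)$ is the minimum cardinality of a vertex cover (so $\alpha(G)+\tau(G)=|V(G)|$). The $\sigma_v$-cover number $\sigma_{v}(G)$ is the maximum natural number $m$ such that every vertex of $G$ belongs to a maximal stable set with at least $m$ vertices. -}

module Defs where

open import Data.Nat using (ℕ; _≤_)
open import Data.Bool using (Bool; true; false)
open import Data.Fin using (Fin)
open import Data.Fin.Subset using (Subset; _∈_; _⊆_; ∣_∣)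
open import Data.Product using (Σ; ∃; _×_)
open import Relation.Binary.PropositionalEquality using (_≡_)

record Graph (n : ℕ) : Set where
  field
    adj   : Fin n → Fin n → Bool
    sym   : ∀ u v → adj u v ≡ adj v u
    irrefl : ∀ u → adj u u ≡ false

open Graph public

module _ {n : ℕ} (G : Graph n) where

  NoIsolated : Set
  NoIsolated = ∀ v → ∃ λ u → adj G v u ≡ true

  Stable : Subset n → Set
  Stable S = ∀ u v → u ∈ S → v ∈ S → adj G u v ≡ false

  MaximalStable : Subset n → Set
  MaximalStable S = Stable S × (∀ T → Stable T → S ⊆ T → T ⊆ S)

  VertexCover : Subset n → Set
  VertexCover C = ∀ u v → adj G u v ≡ true → (u ∈ C) Data.Sum.⊎ (v ∈ C)
    where import Data.Sum

  IsAlpha : ℕ → Set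
  IsAlpha a = (Σ (Subset n) λ S → Stable S × ∣ S ∣ ≡ a)
            × (∀ S → Stable S → ∣ S ∣ ≤ a)

  IsTau : ℕ → Set
  IsTau t = (Σ (Subset n) λ C → VertexCover C × ∣ C ∣ ≡ t)
          × (∀ C → VertexCover C → t ≤ ∣ C ∣)

  SigmaProp : ℕ → Set
  SigmaProp m = ∀ v → Σ (Subset n) λ S → MaximalStable S × v ∈ S × m ≤ ∣ S ∣

  IsSigmaV : ℕ → Set
  IsSigmaV s = SigmaProp s × (∀ m → SigmaProp m → m ≤ s)

{-# OPTIONS --safe #-}
-- Let C be a minimum vertex cover, so that S = ∁ C is a maximum stable set, |S| = α and
-- |C| = τ; for W ⊆ C let N(W) be the set of neighbours of W in S. A stable W ⊆ C satisfies
-- |W| ≤ |N(W)|, since otherwise W ∪ (S ∖ N(W)) would be a stable set larger than S.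
-- Together with the submodularity of N this makes the surplus |N(W)| − |W| subadditive
-- on unions P ∪ Q with P ∩ Q stable. For v ∈ C choose a stable T ∋ v with
-- |T| ≥ σ_v; then X = T ∩ C has surplus at most α − σ_v, because T ∖ C and N(X) are
-- disjoint subsets of S. As C is the union of these |C| sets and, without isolated
-- vertices, N(C) = S, we get α − τ ≤ τ (α − σ_v).
module Submission where

open import Defs hiding (sym)
open import Data.Nat using (ℕ; _≤_; _+_; _*_; _∸_; zero; suc; _<_; z≤n; z<s; s≤s⁻¹)

open import Algebra.Properties.CommutativeSemigroup using (interchange)
open import Data.Bool using (true)
import Data.Bool as Bool
open import Data.Bool.Properties using (not-¬; ¬-not)
open import Data.Fin using (Fin; fromℕ<; _≟_)
open import Data.Fin.Properties using (any?)
open import Data.Fin.Subset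
  using (Subset; inside; outside; _∈_; _⊆_; ∁; _∩_; _∪_; ⊥; _-_; ∣_∣; Empty)
open import Data.Fin.Subset.Properties
  using (_∈?_; nonempty?; ⊆-antisym; Empty-unique; ∉⊥; ⊥⊆; ∣⊥∣≡0; ∣p∣≤n; ∣∁p∣≡n∸∣p∣; p⊆q⇒∣p∣≤∣q∣;
         ∣p∩q∣≤∣q∣; x∈p⇒∣p-x∣<∣p∣; x∈p∧x≢y⇒x∈p-y; x∈∁p⇒x∉p; x∉p⇒x∈∁p;
         p∩q⊆p; p∩q⊆q; x∈p∩q⁺; x∈p∩q⁻; p⊆p∪q; q⊆p∪q; x∈p∪q⁺; x∈p∪q⁻)
open import Data.Nat.Properties
  using (≤-refl; ≤-trans; ≤-reflexive; ≤-antisym; +-identityʳ; +-suc; *-suc; +-assoc;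
         +-mono-≤; +-monoˡ-≤; +-monoʳ-≤; +-cancelˡ-≤; +-cancelʳ-≤; +-∸-assoc; ∸-monoʳ-≤;
         +-comm; m≤m+n; m≤n+m; m≤n+m∸n; m∸[m∸n]≡n; n≮0; +-commutativeSemigroup; module ≤-Reasoning)
open import Data.Product using (∃-syntax; _×_; _,_; proj₁; proj₂)
open import Data.Sum using (inj₁; inj₂; [_,_]′)
open import Data.Vec using ([]; _∷_; tabulate)
open import Data.Vec.Properties using (lookup∘tabulate; []=⇒lookup; lookup⇒[]=)
open import Function using (_∘_)
open import Level using (Level)
open import Relation.Binary.PropositionalEquality
  using (_≡_; refl; sym; trans; cong; subst)
open import Relation.Nullary using (¬_; Dec; yes; no; does; contradiction)
open import Relation.Nullary.Decidable using (dec-true; _×-dec_)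
open import Relation.Unary using (Pred; Decidable)

private
  variable
    n : ℕ
    ℓ : Level

∣p∪q∣+∣p∩q∣≡∣p∣+∣q∣ : ∀ (p q : Subset n) → ∣ p ∪ q ∣ + ∣ p ∩ q ∣ ≡ ∣ p ∣ + ∣ q ∣
∣p∪q∣+∣p∩q∣≡∣p∣+∣q∣ []            []            = refl
∣p∪q∣+∣p∩q∣≡∣p∣+∣q∣ (inside  ∷ p) (inside  ∷ q) =
  cong suc (trans (+-suc _ _) (trans (cong suc (∣p∪q∣+∣p∩q∣≡∣p∣+∣q∣ p q)) (sym (+-suc _ _))))
∣p∪q∣+∣p∩q∣≡∣p∣+∣q∣ (inside  ∷ p) (outside ∷ q) = cong suc (∣p∪q∣+∣p∩q∣≡∣p∣+∣q∣ p q)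
∣p∪q∣+∣p∩q∣≡∣p∣+∣q∣ (outside ∷ p) (inside  ∷ q) =
  trans (cong suc (∣p∪q∣+∣p∩q∣≡∣p∣+∣q∣ p q)) (sym (+-suc _ _))
∣p∪q∣+∣p∩q∣≡∣p∣+∣q∣ (outside ∷ p) (outside ∷ q) = ∣p∪q∣+∣p∩q∣≡∣p∣+∣q∣ p q

∣p∪q∣≤∣p∣+∣q∣ : ∀ (p q : Subset n) → ∣ p ∪ q ∣ ≤ ∣ p ∣ + ∣ q ∣
∣p∪q∣≤∣p∣+∣q∣ p q = ≤-trans (m≤m+n _ _) (≤-reflexive (∣p∪q∣+∣p∩q∣≡∣p∣+∣q∣ p q))

Empty[p∩q]⇒∣p∪q∣≡∣p∣+∣q∣ : ∀ (p q : Subset n) → Empty (p ∩ q) → ∣ p ∪ q ∣ ≡ ∣ p ∣ + ∣ q ∣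
Empty[p∩q]⇒∣p∪q∣≡∣p∣+∣q∣ {n} p q p∩q-empty = begin
  ∣ p ∪ q ∣                ≡⟨ +-identityʳ _ ⟨
  ∣ p ∪ q ∣ + 0            ≡⟨ cong (∣ p ∪ q ∣ +_) ∣p∩q∣≡0 ⟨
  ∣ p ∪ q ∣ + ∣ p ∩ q ∣    ≡⟨ ∣p∪q∣+∣p∩q∣≡∣p∣+∣q∣ p q ⟩
  ∣ p ∣ + ∣ q ∣            ∎
  where
  open Relation.Binary.PropositionalEquality.≡-Reasoning
  ∣p∩q∣≡0 : ∣ p ∩ q ∣ ≡ 0
  ∣p∩q∣≡0 = trans (cong ∣_∣ (Empty-unique p∩q-empty)) (∣⊥∣≡0 n)

∣p∣≤∣p∩q∣+∣p∩∁q∣ : ∀ (p q : Subset n) → ∣ p ∣ ≤ ∣ p ∩ q ∣ + ∣ p ∩ ∁ q ∣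
∣p∣≤∣p∩q∣+∣p∩∁q∣ p q = ≤-trans (p⊆q⇒∣p∣≤∣q∣ split) (∣p∪q∣≤∣p∣+∣q∣ (p ∩ q) (p ∩ ∁ q))
  where
  split : p ⊆ (p ∩ q) ∪ (p ∩ ∁ q)
  split {x} x∈p with x ∈? q
  ... | yes x∈q = x∈p∪q⁺ (inj₁ (x∈p∩q⁺ (x∈p , x∈q)))
  ... | no  x∉q = x∈p∪q⁺ (inj₂ (x∈p∩q⁺ (x∈p , x∉p⇒x∈∁p x∉q)))

satisfying : {P : Pred (Fin n) ℓ} → Decidable P → Subset n
satisfying P? = tabulate (does ∘ P?)

module _ {P : Pred (Fin n) ℓ} (P? : Decidable P) where

  ∈-satisfying⁺ : ∀ {x} → P x → x ∈ satisfying P?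
  ∈-satisfying⁺ {x} Px =
    lookup⇒[]= x (satisfying P?) (trans (lookup∘tabulate (does ∘ P?) x) (dec-true (P? x) Px))

  ∈-satisfying⁻ : ∀ {x} → x ∈ satisfying P? → P x
  ∈-satisfying⁻ {x} x∈ with P? x | trans (sym (lookup∘tabulate (does ∘ P?) x)) ([]=⇒lookup x∈)
  ... | yes Px | _ = Px
  ... | no  _  | ()

m+n≤o+p⇒n≤o∸m+p : ∀ m n o p → m + n ≤ o + p → n ≤ (o ∸ m) + p
m+n≤o+p⇒n≤o∸m+p m n o p m+n≤o+p = +-cancelˡ-≤ m n ((o ∸ m) + p) (begin
  m + n               ≤⟨ m+n≤o+p ⟩
  o + p               ≤⟨ +-monoˡ-≤ p (m≤n+m∸n o m) ⟩
  (m + (o ∸ m)) + p   ≡⟨ +-assoc m (o ∸ m) p ⟩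
  m + ((o ∸ m) + p)   ∎)
  where open ≤-Reasoning

-- 1 + m ∸ s is (1 + m) ∸ s, which agrees with 1 + (m ∸ s) only when s ≤ m.
m≤t+t*[m∸s]⇒m≤t*[1+m∸s] : ∀ {m s} t → m ≤ t + t * (m ∸ s) → (0 < m → s ≤ m) → m ≤ t * (1 + m ∸ s)
m≤t+t*[m∸s]⇒m≤t*[1+m∸s] {0}         t _     _      = z≤n
m≤t+t*[m∸s]⇒m≤t*[1+m∸s] {m@(suc _)} {s} t bound s≤m = begin
  m                   ≤⟨ bound ⟩
  t + t * (m ∸ s)     ≡⟨ *-suc t (m ∸ s) ⟨
  t * (1 + (m ∸ s))   ≡⟨ cong (t *_) (+-∸-assoc 1 (s≤m z<s)) ⟨
  t * (1 + m ∸ s)     ∎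
  where open ≤-Reasoning

module _ (G : Graph n) where

  Adjacent : Fin n → Fin n → Set
  Adjacent u v = adj G u v ≡ true

  stable⇒¬adjacent : ∀ {T u v} → Stable G T → u ∈ T → v ∈ T → ¬ Adjacent u v
  stable⇒¬adjacent T-stable u∈T v∈T uv = not-¬ uv (T-stable _ _ u∈T v∈T)

  stable-⊆ : ∀ {P Q} → Stable G Q → P ⊆ Q → Stable G P
  stable-⊆ Q-stable P⊆Q u v u∈P v∈P = Q-stable u v (P⊆Q u∈P) (P⊆Q v∈P)

  stable-∪ : ∀ {P Q} → Stable G P → Stable G Q →
             (∀ {u v} → u ∈ P → v ∈ Q → ¬ Adjacent u v) → Stable G (P ∪ Q)
  stable-∪ {P} {Q} P-stable Q-stable no-edge u v u∈ v∈ with x∈p∪q⁻ P Q u∈ | x∈p∪q⁻ P Q v∈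
  ... | inj₁ u∈P | inj₁ v∈P = P-stable u v u∈P v∈P
  ... | inj₂ u∈Q | inj₂ v∈Q = Q-stable u v u∈Q v∈Q
  ... | inj₁ u∈P | inj₂ v∈Q = ¬-not (no-edge u∈P v∈Q)
  ... | inj₂ u∈Q | inj₁ v∈P = ¬-not (no-edge v∈P u∈Q ∘ trans (Graph.sym G v u))

  cover⇒∁-stable : ∀ {C} → VertexCover G C → Stable G (∁ C)
  cover⇒∁-stable C-cover u v u∈∁C v∈∁C =
    ¬-not ([ x∈∁p⇒x∉p u∈∁C , x∈∁p⇒x∉p v∈∁C ]′ ∘ C-cover u v)

  stable⇒∁-cover : ∀ {S} → Stable G S → VertexCover G (∁ S)
  stable⇒∁-cover {S} S-stable u v uv with u ∈? S | v ∈? S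
  ... | yes u∈S | yes v∈S = contradiction uv (stable⇒¬adjacent S-stable u∈S v∈S)
  ... | no  u∉S | _       = inj₁ (x∉p⇒x∈∁p u∉S)
  ... | yes _   | no  v∉S = inj₂ (x∉p⇒x∈∁p v∉S)

  minimumCover⇒∣∁C∣≡α : ∀ {a C} → IsAlpha G a → VertexCover G C →
                         (∀ D → VertexCover G D → ∣ C ∣ ≤ ∣ D ∣) → ∣ ∁ C ∣ ≡ a
  minimumCover⇒∣∁C∣≡α {C = C} ((S , S-stable , refl) , α-max) C-cover C-minimum =
    ≤-antisym (α-max (∁ C) (cover⇒∁-stable C-cover)) (begin
      ∣ S ∣                ≡⟨ m∸[m∸n]≡n (∣p∣≤n S) ⟨
      n ∸ (n ∸ ∣ S ∣)      ≡⟨ cong (n ∸_) (∣∁p∣≡n∸∣p∣ S) ⟨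
      n ∸ ∣ ∁ S ∣          ≤⟨ ∸-monoʳ-≤ n (C-minimum (∁ S) (stable⇒∁-cover S-stable)) ⟩
      n ∸ ∣ C ∣            ≡⟨ ∣∁p∣≡n∸∣p∣ C ⟨
      ∣ ∁ C ∣              ∎)
    where open ≤-Reasoning

  neighbourIn? : ∀ S Z y → Dec (y ∈ S × ∃[ z ] z ∈ Z × Adjacent z y)
  neighbourIn? S Z y = (y ∈? S) ×-dec any? (λ z → (z ∈? Z) ×-dec (adj G z y Bool.≟ true))

  N : Subset n → Subset n → Subset n
  N S Z = satisfying (neighbourIn? S Z)

  ∈N⁺ : ∀ {S Z y z} → y ∈ S → z ∈ Z → Adjacent z y → y ∈ N S Z
  ∈N⁺ {S} {Z} y∈S z∈Z zy = ∈-satisfying⁺ (neighbourIn? S Z) (y∈S , _ , z∈Z , zy)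

  ∈N⁻ : ∀ {S Z y} → y ∈ N S Z → y ∈ S × ∃[ z ] z ∈ Z × Adjacent z y
  ∈N⁻ {S} {Z} = ∈-satisfying⁻ (neighbourIn? S Z)

  N[⊥]⊆⊥ : ∀ S → N S ⊥ ⊆ ⊥
  N[⊥]⊆⊥ S y∈ = contradiction (proj₁ (proj₂ (proj₂ (∈N⁻ y∈)))) ∉⊥

  N[p∪q]⊆N[p]∪N[q] : ∀ S p q → N S (p ∪ q) ⊆ N S p ∪ N S q
  N[p∪q]⊆N[p]∪N[q] S p q y∈ with ∈N⁻ y∈
  ... | y∈S , z , z∈p∪q , zy with x∈p∪q⁻ p q z∈p∪q
  ...   | inj₁ z∈p = x∈p∪q⁺ (inj₁ (∈N⁺ y∈S z∈p zy))
  ...   | inj₂ z∈q = x∈p∪q⁺ (inj₂ (∈N⁺ y∈S z∈q zy))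

  N[p∩q]⊆N[p]∩N[q] : ∀ S p q → N S (p ∩ q) ⊆ N S p ∩ N S q
  N[p∩q]⊆N[p]∩N[q] S p q y∈ with ∈N⁻ y∈
  ... | y∈S , z , z∈p∩q , zy with x∈p∩q⁻ p q z∈p∩q
  ...   | z∈p , z∈q = x∈p∩q⁺ (∈N⁺ y∈S z∈p zy , ∈N⁺ y∈S z∈q zy)

  ∣N[p∪q]∣+∣N[p∩q]∣≤∣N[p]∣+∣N[q]∣ : ∀ S p q →
    ∣ N S (p ∪ q) ∣ + ∣ N S (p ∩ q) ∣ ≤ ∣ N S p ∣ + ∣ N S q ∣
  ∣N[p∪q]∣+∣N[p∩q]∣≤∣N[p]∣+∣N[q]∣ S p q = begin
    ∣ N S (p ∪ q) ∣ + ∣ N S (p ∩ q) ∣      ≤⟨ +-mono-≤ (p⊆q⇒∣p∣≤∣q∣ (N[p∪q]⊆N[p]∪N[q] S p q))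
                                                       (p⊆q⇒∣p∣≤∣q∣ (N[p∩q]⊆N[p]∩N[q] S p q)) ⟩
    ∣ N S p ∪ N S q ∣ + ∣ N S p ∩ N S q ∣  ≡⟨ ∣p∪q∣+∣p∩q∣≡∣p∣+∣q∣ (N S p) (N S q) ⟩
    ∣ N S p ∣ + ∣ N S q ∣                  ∎
    where open ≤-Reasoning

  ∣N[T∩C]∣≤∣∁C∣∸s+∣T∩C∣ : ∀ {s} C T → Stable G T → s ≤ ∣ T ∣ →
                           ∣ N (∁ C) (T ∩ C) ∣ ≤ (∣ ∁ C ∣ ∸ s) + ∣ T ∩ C ∣
  ∣N[T∩C]∣≤∣∁C∣∸s+∣T∩C∣ {s} C T T-stable s≤∣T∣ =
    m+n≤o+p⇒n≤o∸m+p s (∣ N[X] ∣) (∣ ∁ C ∣) (∣ X ∣) (begin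
      s + ∣ N[X] ∣                         ≤⟨ +-monoˡ-≤ _ s≤∣T∣ ⟩
      ∣ T ∣ + ∣ N[X] ∣                     ≤⟨ +-monoˡ-≤ _ (∣p∣≤∣p∩q∣+∣p∩∁q∣ T C) ⟩
      (∣ X ∣ + ∣ T ∩ ∁ C ∣) + ∣ N[X] ∣     ≡⟨ +-assoc ∣ X ∣ _ _ ⟩
      ∣ X ∣ + (∣ T ∩ ∁ C ∣ + ∣ N[X] ∣)     ≡⟨ cong (∣ X ∣ +_) (Empty[p∩q]⇒∣p∪q∣≡∣p∣+∣q∣ _ _ disjoint) ⟨
      ∣ X ∣ + ∣ (T ∩ ∁ C) ∪ N[X] ∣         ≤⟨ +-monoʳ-≤ ∣ X ∣ (p⊆q⇒∣p∣≤∣q∣ union⊆∁C) ⟩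
      ∣ X ∣ + ∣ ∁ C ∣                      ≡⟨ +-comm ∣ X ∣ _ ⟩
      ∣ ∁ C ∣ + ∣ X ∣                      ∎)
    where
    open ≤-Reasoning
    X N[X] : Subset n
    X    = T ∩ C
    N[X] = N (∁ C) X
    disjoint : Empty ((T ∩ ∁ C) ∩ N[X])
    disjoint (y , y∈) with x∈p∩q⁻ _ N[X] y∈
    ... | y∈T∩∁C , y∈N[X] with ∈N⁻ y∈N[X]
    ...   | _ , z , z∈X , zy = stable⇒¬adjacent T-stable (p∩q⊆p T C z∈X) (p∩q⊆p T (∁ C) y∈T∩∁C) zy
    union⊆∁C : (T ∩ ∁ C) ∪ N[X] ⊆ ∁ C
    union⊆∁C y∈ with x∈p∪q⁻ (T ∩ ∁ C) N[X] y∈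
    ... | inj₁ y∈T∩∁C = p∩q⊆q T (∁ C) y∈T∩∁C
    ... | inj₂ y∈N[X] = proj₁ (∈N⁻ y∈N[X])

  module MinimumCover {C : Subset n} (C-cover : VertexCover G C)
                      (∁C-maximum : ∀ T → Stable G T → ∣ T ∣ ≤ ∣ ∁ C ∣) where

    ∣Z∣≤∣N[Z]∣ : ∀ {Z} → Stable G Z → Z ⊆ C → ∣ Z ∣ ≤ ∣ N (∁ C) Z ∣
    ∣Z∣≤∣N[Z]∣ {Z} Z-stable Z⊆C = +-cancelʳ-≤ ∣ R ∣ _ _ (begin
      ∣ Z ∣ + ∣ R ∣                  ≡⟨ Empty[p∩q]⇒∣p∪q∣≡∣p∣+∣q∣ Z R Z∩R-empty ⟨
      ∣ Z ∪ R ∣                      ≤⟨ ∁C-maximum (Z ∪ R) Z∪R-stable ⟩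
      ∣ ∁ C ∣                        ≤⟨ ∣p∣≤∣p∩q∣+∣p∩∁q∣ (∁ C) (N (∁ C) Z) ⟩
      ∣ ∁ C ∩ N (∁ C) Z ∣ + ∣ R ∣    ≤⟨ +-monoˡ-≤ ∣ R ∣ (∣p∩q∣≤∣q∣ (∁ C) (N (∁ C) Z)) ⟩
      ∣ N (∁ C) Z ∣ + ∣ R ∣          ∎)
      where
      open ≤-Reasoning
      R : Subset n
      R = ∁ C ∩ ∁ (N (∁ C) Z)
      Z∩R-empty : Empty (Z ∩ R)
      Z∩R-empty (y , y∈Z∩R) with x∈p∩q⁻ Z R y∈Z∩R
      ... | y∈Z , y∈R = x∈∁p⇒x∉p (p∩q⊆p (∁ C) _ y∈R) (Z⊆C y∈Z)
      Z∪R-stable : Stable G (Z ∪ R)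
      Z∪R-stable = stable-∪ Z-stable (stable-⊆ (cover⇒∁-stable C-cover) (p∩q⊆p (∁ C) _))
        λ z∈Z y∈R zy → x∈∁p⇒x∉p (p∩q⊆q (∁ C) _ y∈R) (∈N⁺ (p∩q⊆p (∁ C) _ y∈R) z∈Z zy)

    surplus-∪ : ∀ {P Q k l} → Stable G (P ∩ Q) → P ∩ Q ⊆ C →
                ∣ N (∁ C) P ∣ ≤ k + ∣ P ∣ → ∣ N (∁ C) Q ∣ ≤ l + ∣ Q ∣ →
                ∣ N (∁ C) (P ∪ Q) ∣ ≤ (k + l) + ∣ P ∪ Q ∣
    surplus-∪ {P} {Q} {k} {l} P∩Q-stable P∩Q⊆C P-surplus Q-surplus =
      +-cancelʳ-≤ ∣ P ∩ Q ∣ _ _ (begin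
        ∣ N (∁ C) (P ∪ Q) ∣ + ∣ P ∩ Q ∣              ≤⟨ +-monoʳ-≤ _ (∣Z∣≤∣N[Z]∣ P∩Q-stable P∩Q⊆C) ⟩
        ∣ N (∁ C) (P ∪ Q) ∣ + ∣ N (∁ C) (P ∩ Q) ∣    ≤⟨ ∣N[p∪q]∣+∣N[p∩q]∣≤∣N[p]∣+∣N[q]∣ (∁ C) P Q ⟩
        ∣ N (∁ C) P ∣ + ∣ N (∁ C) Q ∣                ≤⟨ +-mono-≤ P-surplus Q-surplus ⟩
        (k + ∣ P ∣) + (l + ∣ Q ∣)                    ≡⟨ interchange +-commutativeSemigroup k (∣ P ∣) l (∣ Q ∣) ⟩
        (k + l) + (∣ P ∣ + ∣ Q ∣)                    ≡⟨ cong ((k + l) +_) (∣p∪q∣+∣p∩q∣≡∣p∣+∣q∣ P Q) ⟨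
        (k + l) + (∣ P ∪ Q ∣ + ∣ P ∩ Q ∣)            ≡⟨ +-assoc (k + l) _ _ ⟨
        ((k + l) + ∣ P ∪ Q ∣) + ∣ P ∩ Q ∣            ∎)
      where open ≤-Reasoning

    module _ {k} (X : Fin n → Subset n) (X-stable : ∀ v → Stable G (X v)) (X⊆C : ∀ v → X v ⊆ C)
             (X-surplus : ∀ v → ∣ N (∁ C) (X v) ∣ ≤ k + ∣ X v ∣) where

      ⋃-surplus : ∀ m A → ∣ A ∣ ≤ m →
                  ∃[ W ] W ⊆ C × (∀ {v} → v ∈ A → X v ⊆ W) × ∣ N (∁ C) W ∣ ≤ m * k + ∣ W ∣
      ⋃-surplus m A ∣A∣≤m with nonempty? A
      ... | no A-empty = ⊥ , ⊥⊆ , (λ v∈A → contradiction (_ , v∈A) A-empty) ,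
                         ≤-trans (p⊆q⇒∣p∣≤∣q∣ (N[⊥]⊆⊥ (∁ C))) (m≤n+m (∣ ⊥ {n} ∣) (m * k))
      ⋃-surplus zero    A ∣A∣≤0   | yes (v , v∈A) =
        contradiction (≤-trans (x∈p⇒∣p-x∣<∣p∣ v∈A) ∣A∣≤0) n≮0
      ⋃-surplus (suc m) A ∣A∣≤1+m | yes (v , v∈A)
        with ⋃-surplus m (A - v) (s≤s⁻¹ (≤-trans (x∈p⇒∣p-x∣<∣p∣ v∈A) ∣A∣≤1+m))
      ... | W , W⊆C , X⊆W , W-surplus = X v ∪ W , X[v]∪W⊆C , X⊆X[v]∪W ,
            surplus-∪ (stable-⊆ (X-stable v) (p∩q⊆p (X v) W)) (X⊆C v ∘ p∩q⊆p (X v) W)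
                      (X-surplus v) W-surplus
        where
        X[v]∪W⊆C : X v ∪ W ⊆ C
        X[v]∪W⊆C y∈ = [ X⊆C v , W⊆C ]′ (x∈p∪q⁻ (X v) W y∈)
        X⊆X[v]∪W : ∀ {u} → u ∈ A → X u ⊆ X v ∪ W
        X⊆X[v]∪W {u} u∈A with u ≟ v
        ... | yes refl = p⊆p∪q W
        ... | no  u≢v  = q⊆p∪q (X v) W ∘ X⊆W (x∈p∧x≢y⇒x∈p-y u∈A u≢v)

      C-surplus : (∀ {v} → v ∈ C → v ∈ X v) → ∣ N (∁ C) C ∣ ≤ ∣ C ∣ * k + ∣ C ∣
      C-surplus v∈X[v] with ⋃-surplus ∣ C ∣ C ≤-refl
      ... | W , W⊆C , X⊆W , W-surplus =
        subst (λ W → ∣ N (∁ C) W ∣ ≤ ∣ C ∣ * k + ∣ W ∣)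
              (⊆-antisym W⊆C (λ v∈C → X⊆W v∈C (v∈X[v] v∈C))) W-surplus

    ∁C⊆N[C] : NoIsolated G → ∁ C ⊆ N (∁ C) C
    ∁C⊆N[C] no-isolated {y} y∈∁C with no-isolated y
    ... | u , yu with C-cover y u yu
    ...   | inj₁ y∈C = contradiction y∈C (x∈∁p⇒x∉p y∈∁C)
    ...   | inj₂ u∈C = ∈N⁺ y∈∁C u∈C (trans (Graph.sym G u y) yu)

    ∣∁C∣≤∣C∣+∣C∣*[∣∁C∣∸s] : ∀ {s} → NoIsolated G → (∀ v → ∃[ T ] Stable G T × v ∈ T × s ≤ ∣ T ∣) →
                            ∣ ∁ C ∣ ≤ ∣ C ∣ + ∣ C ∣ * (∣ ∁ C ∣ ∸ s)
    ∣∁C∣≤∣C∣+∣C∣*[∣∁C∣∸s] {s} no-isolated large = begin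
      ∣ ∁ C ∣                    ≤⟨ p⊆q⇒∣p∣≤∣q∣ (∁C⊆N[C] no-isolated) ⟩
      ∣ N (∁ C) C ∣              ≤⟨ C-surplus X X-stable (λ v → p∩q⊆q (T v) C) X-surplus v∈X[v] ⟩
      ∣ C ∣ * k + ∣ C ∣          ≡⟨ +-comm (∣ C ∣ * k) _ ⟩
      ∣ C ∣ + ∣ C ∣ * k          ∎
      where
      open ≤-Reasoning
      k : ℕ
      k = ∣ ∁ C ∣ ∸ s
      T X : Fin n → Subset n
      T v = proj₁ (large v)
      X v = T v ∩ C
      T-stable : ∀ v → Stable G (T v)
      T-stable v = proj₁ (proj₂ (large v))
      X-stable : ∀ v → Stable G (X v)
      X-stable v = stable-⊆ (T-stable v) (p∩q⊆p (T v) C)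
      X-surplus : ∀ v → ∣ N (∁ C) (X v) ∣ ≤ k + ∣ X v ∣
      X-surplus v = ∣N[T∩C]∣≤∣∁C∣∸s+∣T∩C∣ C (T v) (T-stable v) (proj₂ (proj₂ (proj₂ (large v))))
      v∈X[v] : ∀ {v} → v ∈ C → v ∈ X v
      v∈X[v] {v} v∈C = x∈p∩q⁺ (proj₁ (proj₂ (proj₂ (large v))) , v∈C)

theorem2p1 : ∀ {n} (G : Graph n) → NoIsolated G →
    ∀ a t s → IsAlpha G a → IsTau G t → IsSigmaV G s →
      a ≤ t * (1 + a ∸ s)
theorem2p1 {n} G no-isolated a t s α@(_ , α-max) ((C , C-cover , refl) , C-minimum) (σ , _) =
  m≤t+t*[m∸s]⇒m≤t*[1+m∸s] ∣ C ∣ a≤∣C∣+∣C∣*[a∸s] s≤a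
  where
  open MinimumCover G C-cover
  ∣∁C∣≡a : ∣ ∁ C ∣ ≡ a
  ∣∁C∣≡a = minimumCover⇒∣∁C∣≡α G α C-cover C-minimum
  large : ∀ v → ∃[ T ] Stable G T × v ∈ T × s ≤ ∣ T ∣
  large v with σ v
  ... | T , (T-stable , _) , v∈T , s≤∣T∣ = T , T-stable , v∈T , s≤∣T∣
  a≤∣C∣+∣C∣*[a∸s] : a ≤ ∣ C ∣ + ∣ C ∣ * (a ∸ s)
  a≤∣C∣+∣C∣*[a∸s] = subst (λ a → a ≤ ∣ C ∣ + ∣ C ∣ * (a ∸ s)) ∣∁C∣≡a
    (∣∁C∣≤∣C∣+∣C∣*[∣∁C∣∸s] (λ T T-stable → subst (∣ T ∣ ≤_) (sym ∣∁C∣≡a) (α-max T T-stable))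
                           no-isolated large)
  s≤a : 0 < a → s ≤ a
  s≤a 0<a with σ (fromℕ< (≤-trans 0<a (subst (_≤ n) ∣∁C∣≡a (∣p∣≤n (∁ C)))))
  ... | T , (T-stable , _) , _ , s≤∣T∣ = ≤-trans s≤∣T∣ (α-max T T-stable)
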